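{- Suppose there is an oracle that decides, for each Boolean combination $G$ of elements of ${\cal G}_{\cal A}$, whether $G=\emptyset$. Then for every formula $\phi\in{\cal L}^C_{\cal G}$ one can effectively find a set ${\cal A}'$ of at most $2^{|\phi|}$ agents and a formula $\phi^\sigma$ in the language ${\cal L}^C_{{\cal G}'}$, where ${\cal G}'$ consists of all nonempty subsets of ${\cal A}'$, such that $|\phi^\sigma|=|\phi|$ and $\phi$ is satisfiable in ${\cal M}_{\cal A}$ iff $\phi^\sigma$ is satisfiable in ${\cal M}_{{\cal A}'}$.
   Context: ${\cal A}$ is a (possibly infinite) set of agents, ${\cal G}$ a set of nonempty subsets of ${\cal A}$, ${\cal G}_{\cal A}={\cal G}\cup\{\{i\}:i\in{\cal A}\}$. ${\cal L}^C_{\cal G}$ is the smallest set of formulas containing a fixed set $\Phi$ of primitive propositions and closed under $\wedge,\neg$, $K_i$ ($i\in{\cal A}$), $E_G,C_G$ ($G\in{\cal G}$); $|\phi|$ is its length with primitive propositions, $K_i$, $E_G$ of length 1 and $C_G$ of length 3 regardless of $G$. Kripke structures $M=(S,\pi,\{{\cal K}_i\}_{i\in{\cal A}})$, with $(M,s)\models K_i\phi$ iff $\phi$ holds at all ${\cal K}_i$-successors of $s$, $(M,s)\models E_G\phi$ iff $(M,s)\models K_i\phi$ for all $i\in G$, $(M,s)\models C_G\phi$ iff $(M,s)\models E_G^k\phi$ for all $k\ge1$. ${\cal M}_{\cal A}$ is the class of all Kripke structures over ${\cal A}$ (no restrictions on the relations). -}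

module Defs where

open import Data.Nat using (ℕ; zero; suc; _+_)
open import Data.Bool using (Bool; true)
open import Data.Product using (Σ; ∃; _×_; _,_)
open import Data.Sum using (_⊎_; inj₁; inj₂)
open import Data.Empty using (⊥)
open import Data.Fin using (Fin)
open import Data.Fin.Subset using (Subset; Nonempty; _∈_)
open import Relation.Nullary using (¬_)
open import Relation.Binary.PropositionalEquality using (_≡_)

-- Formulas of L^C_G over primitive propositions Φ, agents A and
-- group indices Gr (each group index denotes a nonempty set of agents
-- via a membership predicate supplied separately).
data Form (Φ A Gr : Set) : Set where
  prim : Φ → Form Φ A Gr
  _∧'_ : Form Φ A Gr → Form Φ A Gr → Form Φ A Gr
  ¬'_  : Form Φ A Gr → Form Φ A Gr
  K    : A → Form Φ A Gr → Form Φ A Gr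
  E    : Gr → Form Φ A Gr → Form Φ A Gr
  C    : Gr → Form Φ A Gr → Form Φ A Gr

∣_∣ : ∀ {Φ A Gr} → Form Φ A Gr → ℕ
∣ prim p ∣   = 1
∣ φ ∧' ψ ∣   = ∣ φ ∣ + ∣ ψ ∣ + 1
∣ ¬' φ ∣     = ∣ φ ∣ + 1
∣ K i φ ∣    = ∣ φ ∣ + 1
∣ E g φ ∣    = ∣ φ ∣ + 1
∣ C g φ ∣    = ∣ φ ∣ + 3

-- Kripke structures over agents A (no restrictions on the relations).
record Kripke (Φ A : Set) : Set₁ where
  field
    S  : Set
    π  : S → Φ → Bool
    𝒦  : A → S → S → Set

module _ {Φ A Gr : Set} (mem : Gr → A → Set) (M : Kripke Φ A) where
  open Kripke M

  Kop : A → (S → Set) → S → Set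
  Kop i P s = ∀ t → 𝒦 i s t → P t

  Eop : Gr → (S → Set) → S → Set
  Eop g P s = ∀ i → mem g i → Kop i P s

  -- E_G^k P for k ≥ 1 : Eiter g P k = E_G^{k+1} P
  Eiter : Gr → (S → Set) → ℕ → S → Set
  Eiter g P zero    = Eop g P
  Eiter g P (suc k) = Eop g (Eiter g P k)

  _⊨_ : S → Form Φ A Gr → Set
  s ⊨ prim p   = π s p ≡ true
  s ⊨ (φ ∧' ψ) = (s ⊨ φ) × (s ⊨ ψ)
  s ⊨ (¬' φ)   = ¬ (s ⊨ φ)
  s ⊨ K i φ    = Kop i (λ t → t ⊨ φ) s
  s ⊨ E g φ    = Eop g (λ t → t ⊨ φ) s
  s ⊨ C g φ    = ∀ k → Eiter g (λ t → t ⊨ φ) k s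

Satisfiable : ∀ {Φ A Gr : Set} → (Gr → A → Set) → Form Φ A Gr → Set₁
Satisfiable {Φ} {A} mem φ = Σ (Kripke Φ A) λ M → Σ (Kripke.S M) λ s → _⊨_ mem M s φ

data BExp (X : Set) : Set where
  atom : X → BExp X
  compl : BExp X → BExp X
  _∩_ : BExp X → BExp X → BExp X
  _∪_ : BExp X → BExp X → BExp X

⟦_⟧B : ∀ {X A : Set} → BExp X → (X → A → Set) → A → Set
⟦ atom x ⟧B m a  = m x a
⟦ compl b ⟧B m a = ¬ (⟦ b ⟧B m a)
⟦ b ∩ c ⟧B m a   = ⟦ b ⟧B m a × ⟦ c ⟧B m a
⟦ b ∪ c ⟧B m a   = ⟦ b ⟧B m a ⊎ ⟦ c ⟧B m a

-- G_A = G ∪ {{i} : i ∈ A}, membership predicate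
memGA : ∀ {A Gr : Set} → (Gr → A → Set) → (Gr ⊎ A) → A → Set
memGA mem (inj₁ g) a = mem g a
memGA mem (inj₂ i) a = i ≡ a

IsEmpty : ∀ {X A : Set} → (X → A → Set) → BExp X → Set
IsEmpty {A = A} m b = ∀ (a : A) → ¬ ⟦ b ⟧B m a

NESub : ℕ → Set
NESub n = Σ (Subset n) Nonempty

memNE : ∀ {n} → NESub n → Fin n → Set
memNE (X , _) i = i ∈ X

-- The operators K_i, E_G, C_G of φ mention at most |φ| sets of agents G₁ … G_m
-- (singletons for K_i). Agents in the same Venn region of these sets are
-- indistinguishable to φ, so the new agents are the 2^m sign vectors, G_j becomes
-- the set G'_j of regions meeting G_j (the oracle decides which), and φ^σ uses
-- E_{G'_j} or C_{G'_j} at the j-th operator. A structure over agents turns into one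
-- over regions by giving each region the union of its agents' relations, and back
-- by giving each agent the relation of its region; either way E_{G_j} and E_{G'_j}
-- coincide. Constructively an agent lies in some region only up to double
-- negation, which suffices because satisfaction is ¬¬-stable.
module Submission where

open import Defs
open import Data.Nat using (ℕ; _≤_; _^_; suc; _+_; z≤n; s≤s)
open import Data.Nat.Properties using (^-monoʳ-≤; ≤-trans; m≤m+n; +-mono-≤; +-suc)
open import Data.Fin using (Fin; zero; suc; finToFun; funToFin)
open import Data.Fin.Properties using (finToFun-funToFin)
open import Data.Fin.Subset using (Subset; Nonempty) renaming (_∈_ to _∈ₛ_)
open import Data.Fin.Subset.Properties using (nonempty?)
open import Data.Vec using (tabulate)
open import Data.Vec.Properties using (lookup∘tabulate; lookup⇒[]=; []=⇒lookup)
import Data.Vec.Functional as Vector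
open import Data.Bool using (Bool; true)
open import Data.Bool.Properties using (T-≡) renaming (_≟_ to _≟ᵇ_)
open import Data.List using (List; []; _∷_; _++_; length; lookup)
open import Data.List.Properties using (length-++)
open import Data.List.Membership.Propositional using (_∈_)
open import Data.List.Membership.Propositional.Properties using (∈-++⁺ˡ; ∈-++⁺ʳ)
open import Data.List.Relation.Unary.Any using (here; there; index)
open import Data.List.Relation.Unary.Any.Properties using (lookup-index)
open import Data.Product using (Σ; ∃; _×_; _,_; proj₁; proj₂)
open import Data.Product.Function.NonDependent.Propositional using (_×-⇔_)
open import Data.Sum using (_⊎_; inj₁; inj₂)
open import Function using (_∘_)
open import Function.Bundles using (_⇔_; mk⇔; Equivalence)
import Function.Properties.Equivalence as ⇔
open import Function.Related.TypeIsomorphisms using (¬-cong-⇔)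
open import Relation.Nullary using (¬_; Dec; yes; no; ¬?)
open import Relation.Nullary.Negation using (Stable; negated-stable; ¬¬-map; contradiction)
open import Relation.Nullary.Decidable using (decidable-stable; ¬¬-excluded-middle; dec-true; toWitness; isYes; isYes≗does)
open import Relation.Unary using (Decidable)
open import Relation.Binary.PropositionalEquality using (_≡_; refl; sym; trans; cong; cong₂; subst)

open Equivalence using (to; from)

∀-stable : {A : Set} {P : A → Set} → (∀ x → Stable (P x)) → Stable (∀ x → P x)
∀-stable stable ¬¬∀P x = stable x (¬¬-map (λ ∀P → ∀P x) ¬¬∀P)

→-stable : {A B : Set} → Stable B → Stable (A → B)
→-stable stable ¬¬f a = stable (¬¬-map (λ f → f a) ¬¬f)

×-stable : {A B : Set} → Stable A → Stable B → Stable (A × B)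
×-stable stableA stableB ¬¬ab = stableA (¬¬-map proj₁ ¬¬ab) , stableB (¬¬-map proj₂ ¬¬ab)

subsetOf : ∀ {n} {P : Fin n → Set} → Decidable P → Subset n
subsetOf P? = tabulate (isYes ∘ P?)

∈-subsetOf : ∀ {n} {P : Fin n → Set} (P? : Decidable P) {x : Fin n} → x ∈ₛ subsetOf P? ⇔ P x
∈-subsetOf P? {x} = mk⇔
  (λ x∈ → toWitness (from T-≡ (trans (sym (lookup∘tabulate (isYes ∘ P?) x)) ([]=⇒lookup x∈))))
  (λ px → lookup⇒[]= x _
     (trans (lookup∘tabulate (isYes ∘ P?) x) (trans (isYes≗does (P? x)) (dec-true (P? x) px))))

module _ {Φ A Gr : Set} (mem : Gr → A → Set) (M : Kripke Φ A) where
  open Kripke M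

  Kop-stable : ∀ i {P : S → Set} → (∀ t → Stable (P t)) → ∀ s → Stable (Kop mem M i P s)
  Kop-stable i stable s = ∀-stable λ t → →-stable (stable t)

  Eop-stable : ∀ g {P : S → Set} → (∀ t → Stable (P t)) → ∀ s → Stable (Eop mem M g P s)
  Eop-stable g stable s = ∀-stable λ i → →-stable (Kop-stable i stable s)

  Eiter-stable : ∀ g {P : S → Set} → (∀ t → Stable (P t)) → ∀ k s → Stable (Eiter mem M g P k s)
  Eiter-stable g stable ℕ.zero    = Eop-stable g stable
  Eiter-stable g stable (ℕ.suc k) = Eop-stable g (Eiter-stable g stable k)

  Eop-cong : ∀ g {P Q : S → Set} → (∀ t → P t ⇔ Q t) → ∀ s → Eop mem M g P s ⇔ Eop mem M g Q s
  Eop-cong g P⇔Q s = mk⇔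
    (λ h i i∈g t st → to (P⇔Q t) (h i i∈g t st))
    (λ h i i∈g t st → from (P⇔Q t) (h i i∈g t st))

  K⇔E-singleton : ∀ i (P : S → Set) s → Kop mem M i P s ⇔ Eop (memGA mem) M (inj₂ i) P s
  K⇔E-singleton i P s = mk⇔ (λ { h _ refl → h }) (λ h → h i refl)

  Eiter⇔Eiter-memGA : ∀ g (P : S → Set) k s → Eiter mem M g P k s ⇔ Eiter (memGA mem) M (inj₁ g) P k s
  Eiter⇔Eiter-memGA g P ℕ.zero    s = ⇔.refl
  Eiter⇔Eiter-memGA g P (ℕ.suc k) s = Eop-cong g (λ t → Eiter⇔Eiter-memGA g P k t) s

  ⊨-stable : ∀ s ψ → Stable (_⊨_ mem M s ψ)
  ⊨-stable s (prim p)  = decidable-stable (π s p ≟ᵇ true)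
  ⊨-stable s (φ ∧' ψ) = ×-stable (⊨-stable s φ) (⊨-stable s ψ)
  ⊨-stable s (¬' φ)   = negated-stable
  ⊨-stable s (K i φ)  = Kop-stable i (λ t → ⊨-stable t φ) s
  ⊨-stable s (E g φ)  = Eop-stable g (λ t → ⊨-stable t φ) s
  ⊨-stable s (C g φ)  = ∀-stable λ k → Eiter-stable g (λ t → ⊨-stable t φ) k s

suc-≤-+ : ∀ {m n k} → m ≤ n → suc m ≤ n + suc k
suc-≤-+ {m} {n} {k} m≤n = subst (suc m ≤_) (sym (+-suc n k)) (s≤s (≤-trans m≤n (m≤m+n n k)))

occurrences : ∀ {Φ A Gr} → Form Φ A Gr → List (Gr ⊎ A)
occurrences (prim p) = []
occurrences (φ ∧' ψ) = occurrences φ ++ occurrences ψ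
occurrences (¬' φ)   = occurrences φ
occurrences (K i φ)  = inj₂ i ∷ occurrences φ
occurrences (E g φ)  = inj₁ g ∷ occurrences φ
occurrences (C g φ)  = inj₁ g ∷ occurrences φ

length-occurrences≤ : ∀ {Φ A Gr} (ψ : Form Φ A Gr) → length (occurrences ψ) ≤ ∣ ψ ∣
length-occurrences≤ (prim p) = z≤n
length-occurrences≤ (φ ∧' ψ) = subst (_≤ ∣ φ ∣ + ∣ ψ ∣ + 1) (sym (length-++ (occurrences φ)))
  (≤-trans (+-mono-≤ (length-occurrences≤ φ) (length-occurrences≤ ψ)) (m≤m+n _ 1))
length-occurrences≤ (¬' φ)  = ≤-trans (length-occurrences≤ φ) (m≤m+n _ 1)
length-occurrences≤ (K i φ) = suc-≤-+ (length-occurrences≤ φ)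
length-occurrences≤ (E g φ) = suc-≤-+ (length-occurrences≤ φ)
length-occurrences≤ (C g φ) = suc-≤-+ (length-occurrences≤ φ)

-- Labels are attached to occurrences rather than to groups: Gr ⊎ A need not have
-- decidable equality.
Labelling : {X : Set} → List X → Set → Set
Labelling xs L = ∀ {x} → x ∈ xs → L

module _ {X L : Set} where

  labelˡ : ∀ {xs} (ys : List X) → Labelling (xs ++ ys) L → Labelling xs L
  labelˡ ys ℓ p = ℓ (∈-++⁺ˡ p)

  labelʳ : ∀ (xs : List X) {ys} → Labelling (xs ++ ys) L → Labelling ys L
  labelʳ xs ℓ p = ℓ (∈-++⁺ʳ xs p)

  label-head : ∀ {y : X} {xs} → Labelling (y ∷ xs) L → L
  label-head ℓ = ℓ (here refl)

  label-tail : ∀ {y : X} {xs} → Labelling (y ∷ xs) L → Labelling xs L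
  label-tail ℓ p = ℓ (there p)

module _ {Φ A Gr A′ Gr′ : Set} where

  translate : (ψ : Form Φ A Gr) → Labelling (occurrences ψ) Gr′ → Form Φ A′ Gr′
  translate (prim p) ℓ = prim p
  translate (φ ∧' ψ) ℓ = translate φ (labelˡ (occurrences ψ) ℓ) ∧' translate ψ (labelʳ (occurrences φ) ℓ)
  translate (¬' φ)   ℓ = ¬' translate φ ℓ
  translate (K i φ)  ℓ = E (label-head ℓ) (translate φ (label-tail ℓ))
  translate (E g φ)  ℓ = E (label-head ℓ) (translate φ (label-tail ℓ))
  translate (C g φ)  ℓ = C (label-head ℓ) (translate φ (label-tail ℓ))

  ∣translate∣ : (ψ : Form Φ A Gr) (ℓ : Labelling (occurrences ψ) Gr′) → ∣ translate ψ ℓ ∣ ≡ ∣ ψ ∣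
  ∣translate∣ (prim p) ℓ = refl
  ∣translate∣ (φ ∧' ψ) ℓ = cong₂ (λ a b → a + b + 1)
    (∣translate∣ φ (labelˡ (occurrences ψ) ℓ)) (∣translate∣ ψ (labelʳ (occurrences φ) ℓ))
  ∣translate∣ (¬' φ)   ℓ = cong (_+ 1) (∣translate∣ φ ℓ)
  ∣translate∣ (K i φ)  ℓ = cong (_+ 1) (∣translate∣ φ (label-tail ℓ))
  ∣translate∣ (E g φ)  ℓ = cong (_+ 1) (∣translate∣ φ (label-tail ℓ))
  ∣translate∣ (C g φ)  ℓ = cong (_+ 3) (∣translate∣ φ (label-tail ℓ))

module _ {Φ S : Set} (π : S → Φ → Bool) where

  frame : {A : Set} → (A → S → S → Set) → Kripke Φ A
  frame 𝒦 = record { S = S ; π = π ; 𝒦 = 𝒦 }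

  Agree : {A X A′ X′ : Set} → (X → A → Set) → (A → S → S → Set) → (X′ → A′ → Set) → (A′ → S → S → Set)
    → X → X′ → Set₁
  Agree mem 𝒦 mem′ 𝒦′ x x′ = ∀ (P : S → Set) → (∀ t → Stable (P t)) → ∀ s →
    Eop mem (frame 𝒦) x P s ⇔ Eop mem′ (frame 𝒦′) x′ P s

  Eiter-agree : {A X A′ X′ : Set} {mem : X → A → Set} {𝒦 : A → S → S → Set}
    {mem′ : X′ → A′ → Set} {𝒦′ : A′ → S → S → Set} {x : X} {x′ : X′}
    → Agree mem 𝒦 mem′ 𝒦′ x x′ → {P P′ : S → Set} → (∀ t → Stable (P t)) → (∀ t → P t ⇔ P′ t)
    → ∀ k s → Eiter mem (frame 𝒦) x P k s ⇔ Eiter mem′ (frame 𝒦′) x′ P′ k s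
  Eiter-agree {mem′ = mem′} {𝒦′ = 𝒦′} {x′ = x′} agree stable P⇔P′ ℕ.zero s =
    ⇔.trans (agree _ stable s) (Eop-cong mem′ (frame 𝒦′) x′ P⇔P′ s)
  Eiter-agree {mem = mem} {𝒦} {mem′} {𝒦′} {x} {x′} agree stable P⇔P′ (ℕ.suc k) s =
    ⇔.trans (agree _ (Eiter-stable mem (frame 𝒦) x stable k) s)
            (Eop-cong mem′ (frame 𝒦′) x′ (Eiter-agree agree stable P⇔P′ k) s)

  module _ {A Gr A′ Gr′ : Set} (mem : Gr → A → Set) (mem′ : Gr′ → A′ → Set)
           (𝒦 : A → S → S → Set) (𝒦′ : A′ → S → S → Set) where

    Faithful : (xs : List (Gr ⊎ A)) → Labelling xs Gr′ → Set₁
    Faithful xs ℓ = ∀ {x} (p : x ∈ xs) → Agree (memGA mem) 𝒦 mem′ 𝒦′ x (ℓ p)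

    mutual
      ⊨-translate : (ψ : Form Φ A Gr) (ℓ : Labelling (occurrences ψ) Gr′) → Faithful (occurrences ψ) ℓ
        → ∀ s → _⊨_ mem (frame 𝒦) s ψ ⇔ _⊨_ mem′ (frame 𝒦′) s (translate ψ ℓ)
      ⊨-translate (prim p) ℓ faithful s = ⇔.refl
      ⊨-translate (φ ∧' ψ) ℓ faithful s =
        ⊨-translate φ (labelˡ (occurrences ψ) ℓ) (faithful ∘ ∈-++⁺ˡ) s
          ×-⇔ ⊨-translate ψ (labelʳ (occurrences φ) ℓ) (faithful ∘ ∈-++⁺ʳ (occurrences φ)) s
      ⊨-translate (¬' φ) ℓ faithful s = ¬-cong-⇔ (⊨-translate φ ℓ faithful s)
      ⊨-translate (K i φ) ℓ faithful s =
        ⇔.trans (K⇔E-singleton mem (frame 𝒦) i _ s) (modal-⊨-translate φ ℓ faithful s)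
      ⊨-translate (E g φ) ℓ faithful s = modal-⊨-translate φ ℓ faithful s
      ⊨-translate (C g φ) ℓ faithful s = mk⇔
        (λ h k → to (iterates k) (h k)) (λ h k → from (iterates k) (h k))
        where
        iterates : ∀ k → Eiter mem (frame 𝒦) g (λ t → _⊨_ mem (frame 𝒦) t φ) k s
          ⇔ Eiter mem′ (frame 𝒦′) (label-head ℓ) (λ t → _⊨_ mem′ (frame 𝒦′) t (translate φ (label-tail ℓ))) k s
        iterates k = ⇔.trans (Eiter⇔Eiter-memGA mem (frame 𝒦) g _ k s)
          (Eiter-agree (faithful (here refl)) (λ t → ⊨-stable mem (frame 𝒦) t φ)
            (⊨-translate φ (label-tail ℓ) (faithful ∘ there)) k s)

      modal-⊨-translate : ∀ {x} (φ : Form Φ A Gr) (ℓ : Labelling (x ∷ occurrences φ) Gr′)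
        → Faithful (x ∷ occurrences φ) ℓ
        → ∀ s → Eop (memGA mem) (frame 𝒦) x (λ t → _⊨_ mem (frame 𝒦) t φ) s
              ⇔ Eop mem′ (frame 𝒦′) (label-head ℓ) (λ t → _⊨_ mem′ (frame 𝒦′) t (translate φ (label-tail ℓ))) s
      modal-⊨-translate φ ℓ faithful s = ⇔.trans
        (faithful (here refl) _ (λ t → ⊨-stable mem (frame 𝒦) t φ) s)
        (Eop-cong mem′ (frame 𝒦′) (label-head ℓ) (⊨-translate φ (label-tail ℓ) (faithful ∘ there)) s)

translate-satisfiable : {Φ A Gr A′ Gr′ : Set} (mem : Gr → A → Set) (mem′ : Gr′ → A′ → Set)
  (ψ : Form Φ A Gr) (ℓ : Labelling (occurrences ψ) Gr′)
  → (∀ {S} (π : S → Φ → Bool) (𝒦 : A → S → S → Set)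
       → ∃ λ 𝒦′ → Faithful π mem mem′ 𝒦 𝒦′ (occurrences ψ) ℓ)
  → (∀ {S} (π : S → Φ → Bool) (𝒦′ : A′ → S → S → Set)
       → ∃ λ 𝒦 → Faithful π mem mem′ 𝒦 𝒦′ (occurrences ψ) ℓ)
  → Satisfiable mem ψ ⇔ Satisfiable mem′ (translate ψ ℓ)
translate-satisfiable mem mem′ ψ ℓ forth back = mk⇔
  (λ (M , s , s⊨ψ) → let open Kripke M; (𝒦′ , faithful) = forth π 𝒦 in
     frame π 𝒦′ , s , to (⊨-translate π mem mem′ 𝒦 𝒦′ ψ ℓ faithful s) s⊨ψ)
  (λ (M′ , s , s⊨ψ′) → let open Kripke M′ renaming (𝒦 to 𝒦′); (𝒦 , faithful) = back π 𝒦′ in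
     frame π 𝒦 , s , from (⊨-translate π mem mem′ 𝒦 𝒦′ ψ ℓ faithful s) s⊨ψ′)

literal : {X : Set} → Fin 2 → X → BExp X
literal zero    x = compl (atom x)
literal (suc _) x = atom x

module Regions {A X : Set} (memX : X → A → Set) where

  InRegion : ∀ {m} → (Fin m → X) → (Fin m → Fin 2) → A → Set
  InRegion G σ a = ∀ k → ⟦ literal (σ k) (G k) ⟧B memX a

  cell : ∀ {m} → BExp X → (Fin m → X) → (Fin m → Fin 2) → BExp X
  cell {ℕ.zero}  e G σ = e
  cell {ℕ.suc m} e G σ = literal (σ zero) (G zero) ∩ cell e (G ∘ suc) (σ ∘ suc)

  ⟦cell⟧ : ∀ {m} e (G : Fin m → X) σ a → ⟦ cell e G σ ⟧B memX a ⇔ (⟦ e ⟧B memX a × InRegion G σ a)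
  ⟦cell⟧ {ℕ.zero}  e G σ a = mk⇔ (λ a∈e → a∈e , λ ()) proj₁
  ⟦cell⟧ {ℕ.suc m} e G σ a = mk⇔
    (λ (a∈lit , a∈cell) → let (a∈e , a∈R) = to rest a∈cell in a∈e , λ { zero → a∈lit ; (suc k) → a∈R k })
    (λ (a∈e , a∈R) → a∈R zero , from rest (a∈e , a∈R ∘ suc))
    where rest = ⟦cell⟧ e (G ∘ suc) (σ ∘ suc) a

  literal-of : ∀ x a → Dec (memX x a) → ∃ λ d → ⟦ literal d x ⟧B memX a
  literal-of x a (yes a∈x) = suc zero , a∈x
  literal-of x a (no a∉x)  = zero , a∉x

  ¬¬-InRegion : ∀ {m} (G : Fin m → X) a → ¬ ¬ ∃ λ σ → InRegion G σ a
  ¬¬-InRegion {ℕ.zero}  G a ¬∃ = ¬∃ ((λ ()) , (λ ()))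
  ¬¬-InRegion {ℕ.suc m} G a ¬∃ = ¬¬-InRegion (G ∘ suc) a λ (σ , a∈R) →
    ¬¬-excluded-middle λ a∈?G₀ → let (d , a∈lit) = literal-of (G zero) a a∈?G₀ in
      ¬∃ (d Vector.∷ σ , λ { zero → a∈lit ; (suc k) → a∈R k })

  literal-transfer : ∀ d x {a b} → ⟦ literal d x ⟧B memX a → ⟦ literal d x ⟧B memX b → memX x a → memX x b
  literal-transfer zero    x a∉x _   a∈x = contradiction a∈x a∉x
  literal-transfer (suc _) x _   b∈x _   = b∈x

  InRegion-transfer : ∀ {m} {G : Fin m → X} {σ a b} → InRegion G σ a → InRegion G σ b
    → ∀ j → memX (G j) a → memX (G j) b
  InRegion-transfer {G = G} {σ} a∈R b∈R j = literal-transfer (σ j) (G j) (a∈R j) (b∈R j)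

  module Venn (inhabited : ∀ x → ∃ (memX x)) (empty? : ∀ b → Dec (IsEmpty memX b)) (xs : List X) where

    m : ℕ
    m = length xs

    N : ℕ
    N = 2 ^ m

    G : Fin m → X
    G = lookup xs

    _∈Region_ : A → Fin N → Set
    a ∈Region v = InRegion G (finToFun {2} {m} v) a

    ¬¬-∈Region : ∀ a → ¬ ¬ ∃ (a ∈Region_)
    ¬¬-∈Region a = ¬¬-map
      (λ (σ , a∈R) → funToFin σ , λ k →
         subst (λ d → ⟦ literal d (G k) ⟧B memX a) (sym (finToFun-funToFin σ k)) (a∈R k))
      (¬¬-InRegion G a)

    ∈Region-transfer : ∀ {a b v} → a ∈Region v → b ∈Region v → ∀ j → memX (G j) a → memX (G j) b
    ∈Region-transfer {v = v} = InRegion-transfer {G = G} {σ = finToFun {2} {m} v}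

    group : Fin m → Subset N
    group j = subsetOf λ v → ¬? (empty? (cell (atom (G j)) G (finToFun {2} {m} v)))

    ∈-group⁺ : ∀ {j a v} → memX (G j) a → a ∈Region v → v ∈ₛ group j
    ∈-group⁺ {j} {a} a∈G a∈v =
      from (∈-subsetOf _) λ empty → empty a (from (⟦cell⟧ (atom (G j)) G _ a) (a∈G , a∈v))

    ∈-group⁻ : ∀ {j v} → v ∈ₛ group j → ¬ ¬ ∃ λ a → memX (G j) a × a ∈Region v
    ∈-group⁻ {j} v∈ ¬∃ =
      to (∈-subsetOf _) v∈ λ a a∈cell → ¬∃ (a , to (⟦cell⟧ (atom (G j)) G _ a) a∈cell)

    group-nonempty : ∀ j → Nonempty (group j)
    group-nonempty j = decidable-stable (nonempty? (group j)) λ ¬nonempty →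
      let (a , a∈G) = inhabited (G j) in
      ¬¬-∈Region a λ (v , a∈v) → ¬nonempty (v , ∈-group⁺ a∈G a∈v)

    label : Labelling xs (NESub N)
    label p = group (index p) , group-nonempty (index p)

    module _ {S : Set} where

      regionRelation : (A → S → S → Set) → Fin N → S → S → Set
      regionRelation 𝒦 v s t = ∃ λ a → a ∈Region v × 𝒦 a s t

      agentRelation : (Fin N → S → S → Set) → A → S → S → Set
      agentRelation 𝒦′ a s t = ∃ λ v → a ∈Region v × 𝒦′ v s t

      record Compatible (𝒦 : A → S → S → Set) (𝒦′ : Fin N → S → S → Set) : Set where
        field
          -- an unoccupied region lies in no G'_j, so its steps need not be simulated
          region-step : ∀ {v s t} → ¬ ¬ ∃ (_∈Region v) → 𝒦′ v s t → ¬ ¬ regionRelation 𝒦 v s t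
          agent-step  : ∀ {a s t} → 𝒦 a s t → ¬ ¬ agentRelation 𝒦′ a s t

      regionRelation-compatible : ∀ 𝒦 → Compatible 𝒦 (regionRelation 𝒦)
      regionRelation-compatible 𝒦 = record
        { region-step = λ _ a∈v×𝒦 ¬r → ¬r a∈v×𝒦
        ; agent-step  = λ {a} 𝒦ast → ¬¬-map (λ (v , a∈v) → v , a∈v , a , a∈v , 𝒦ast) (¬¬-∈Region a)
        }

      agentRelation-compatible : ∀ 𝒦′ → Compatible (agentRelation 𝒦′) 𝒦′
      agentRelation-compatible 𝒦′ = record
        { region-step = λ {v} occupied 𝒦′vst → ¬¬-map (λ (a , a∈v) → a , a∈v , v , a∈v , 𝒦′vst) occupied
        ; agent-step  = λ v∈a×𝒦′ ¬r → ¬r v∈a×𝒦′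
        }

      compatible⇒agree : ∀ {Φ : Set} {𝒦 𝒦′} → Compatible 𝒦 𝒦′ → (π : S → Φ → Bool) → ∀ {x} (p : x ∈ xs)
        → Agree π memX 𝒦 memNE 𝒦′ x (label p)
      compatible⇒agree {𝒦 = 𝒦} {𝒦′} compatible π p =
        subst (λ y → Agree π memX 𝒦 memNE 𝒦′ y (label p)) (sym (lookup-index p)) (agree (index p))
        where
        open Compatible compatible

        agree : ∀ j → Agree π memX 𝒦 memNE 𝒦′ (G j) (group j , group-nonempty j)
        agree j P stable s = mk⇔
          (λ h v v∈ t 𝒦′vst → stable t λ ¬Pt →
            ∈-group⁻ v∈ λ (b , b∈G , b∈v) →
            region-step (λ ¬∃ → ¬∃ (b , b∈v)) 𝒦′vst λ (a , a∈v , 𝒦ast) →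
            ¬Pt (h a (∈Region-transfer b∈v a∈v j b∈G) t 𝒦ast))
          (λ h a a∈G t 𝒦ast → stable t λ ¬Pt →
            agent-step 𝒦ast λ (v , a∈v , 𝒦′vst) →
            ¬Pt (h v (∈-group⁺ a∈G a∈v) t 𝒦′vst))

memGA-inhabited : {A Gr : Set} {mem : Gr → A → Set} → (∀ g → ∃ (mem g)) → ∀ x → ∃ (memGA mem x)
memGA-inhabited inhabited (inj₁ g) = inhabited g
memGA-inhabited inhabited (inj₂ i) = i , refl

proposition3p5 : (Φ A Gr : Set) (mem : Gr → A → Set)
    → (∀ g → ∃ λ i → mem g i)
    → ((b : BExp (Gr ⊎ A)) → Dec (IsEmpty (memGA mem) b))
    → (φ : Form Φ A Gr)
    → Σ ℕ λ n → Σ (Form Φ (Fin n) (NESub n)) λ φσ →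
        (n ≤ 2 ^ ∣ φ ∣) × (∣ φσ ∣ ≡ ∣ φ ∣) × (Satisfiable mem φ ⇔ Satisfiable memNE φσ)
proposition3p5 Φ A Gr mem inhabited empty? φ =
  N , translate φ label , ^-monoʳ-≤ 2 (length-occurrences≤ φ) , ∣translate∣ φ label ,
  translate-satisfiable mem memNE φ label
    (λ π 𝒦 → regionRelation 𝒦 , compatible⇒agree (regionRelation-compatible 𝒦) π)
    (λ π 𝒦′ → agentRelation 𝒦′ , compatible⇒agree (agentRelation-compatible 𝒦′) π)
  where open Regions.Venn (memGA mem) (memGA-inhabited inhabited) empty? (occurrences φ)
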